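{- Let $\Delta$ be a finite pure $d$-dimensional simplicial complex which is thin (every codimension-one face lies in exactly two chambers) and shellable, with shelling $\leq_S$ and associated restriction map $R$. Let $\leq_C$ be the transitive closure of the relation on chambers "$E\leq_C D$ if $R(E)\leq D$", and let $\leq_C^r$ be the transitive closure of the relation "$E\leq_C^r D$ if $R(E)\leq D$ and $E$ is adjacent to $D$". Then $\leq_C$ and $\leq_C^r$ are the same partial order on the set of chambers.
   Context: Chambers are maximal faces; $F\le G$ means $F$ is a face of $G$. Two chambers are adjacent if they share a codimension-one face. A shelling is a linear order $\leq_S$ on the chambers such that for every chamber $D$ other than the first, $D\cap\bigcup_{E<_S D}E$ is a nonempty union of codimension-one faces of $D$. The restriction map $R$ of the shelling assigns to a chamber $D$ the face of $D$ spanned by those vertices $v$ of $D$ for which $D\setminus v\leq D\cap\bigcup_{E<_S D}E$, where $D\setminus v$ is the codimension-one face of $D$ not containing $v$ (so $R(D)=\emptyset$ for the first chamber). The subscript $C$ refers to the first chamber $C$ of the shelling. -}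

module Defs where

open import Data.Nat using (ℕ; suc; _<_)
open import Data.Fin using (Fin; toℕ; _<_)
open import Data.Fin.Subset using (Subset; _⊆_; _∈_; _-_; ∣_∣)
open import Data.Product using (Σ; ∃; ∃-syntax; _×_)
open import Data.Sum using (_⊎_)
open import Relation.Binary.PropositionalEquality using (_≡_; _≢_)
open import Function.Definitions using (Injective)
open import Relation.Binary.Construct.Closure.Transitive using (TransClosure)

-- A finite pure d-dimensional simplicial complex on vertex set Fin n,
-- given by its m chambers (maximal faces, each with d+1 vertices),
-- enumerated in the order of the shelling: chamber j comes before chamber k
-- in ≤_S iff j < k.
record PureComplex (n d m : ℕ) : Set where
  field
    ch        : Fin m → Subset n
    ch-size   : ∀ i → ∣ ch i ∣ ≡ suc d
    ch-inj    : Injective _≡_ _≡_ ch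

module _ {n d m : ℕ} (Δ : PureComplex n d m) where
  open PureComplex Δ

  IsFace : Subset n → Set
  IsFace F = ∃[ i ] F ⊆ ch i

  IsCodimOneFace : Subset n → Set
  IsCodimOneFace G = IsFace G × ∣ G ∣ ≡ d

  IsCodimOneFaceOf : Subset n → Fin m → Set
  IsCodimOneFaceOf G j = G ⊆ ch j × ∣ G ∣ ≡ d

  Thin : Set
  Thin = ∀ G → IsCodimOneFace G →
           Σ (Fin m) λ i → Σ (Fin m) λ j → i ≢ j × G ⊆ ch i × G ⊆ ch j ×
             (∀ k → G ⊆ ch k → k ≡ i ⊎ k ≡ j)

  -- F is a face of ch j ∩ ⋃_{i < j} ch i (as a subcomplex)
  InEarlier : Fin m → Subset n → Set
  InEarlier j F = F ⊆ ch j × ∃[ i ] (i Data.Fin.< j × F ⊆ ch i)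

  -- the enumeration order is a shelling: for every chamber other than the
  -- first, ch j ∩ ⋃_{i<j} ch i is a nonempty union of codim-one faces of ch j
  IsShelling : Set
  IsShelling = ∀ j → 0 Data.Nat.< toℕ j →
      (∃[ G ] (IsCodimOneFaceOf G j × InEarlier j G))
    × (∀ F → InEarlier j F →
         ∃[ G ] (IsCodimOneFaceOf G j × InEarlier j G × F ⊆ G))

  -- v is a vertex of the restriction R(ch j)
  _∈R_ : Fin n → Fin m → Set
  v ∈R j = v ∈ ch j × InEarlier j (ch j - v)

  R≤ : Fin m → Fin m → Set
  R≤ e j = ∀ v → v ∈R e → v ∈ ch j

  Adjacent : Fin m → Fin m → Set
  Adjacent e j = ∃[ G ] (IsCodimOneFaceOf G e × IsCodimOneFaceOf G j)

  _≤C_ : Fin m → Fin m → Set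
  _≤C_ = TransClosure R≤

  _≤Cr_ : Fin m → Fin m → Set
  _≤Cr_ = TransClosure (λ e j → R≤ e j × Adjacent e j)

-- If R(e) ≤ j with j <_S e, shelling puts ch e ∩ ch j inside a facet G of ch e that
-- lies in an earlier chamber; the vertex of ch e opposite G is then in R(e) but not in
-- ch j.  Hence ≤_C refines the shelling order and is a partial order.  Conversely, for
-- R(e) ≤ j with e <_S j, the facet G of ch j containing ch e ∩ ch j lies in an earlier
-- chamber i, so R(e) ≤ i, and R(i) ≤ j by thinness; induction on j turns every step of
-- ≤_C into a chain of steps between adjacent chambers.
module Submission where

open import Defs
open import Data.Nat as ℕ using (ℕ; suc)
open import Data.Nat.Properties using (0≢1+n; <⇒≱; ≤-reflexive; ≮⇒≥; suc-injective; ≤-<-trans; <-≤-trans)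
open import Data.Fin using (Fin; _<_; _≤_; _≟_)
open import Data.Fin.Properties using (any?; ≤-antisym; ≤-trans; <-irrefl; <-trans; ≤∧≢⇒<)
open import Data.Fin.Induction using (<-wellFounded)
open import Data.Fin.Subset using (Subset; inside; outside; _∈_; _∉_; _⊆_; _-_; _∩_; ∣_∣; Nonempty)
open import Data.Fin.Subset.Properties
  using (_∈?_; ⊆-trans; p⊆q⇒∣p∣≤∣q∣; p⊂q⇒∣p∣<∣q∣; x∈p⇒∣p-x∣<∣p∣; x∈p∧x≢y⇒x∈p-y; p─q⊆p; p─⊥≡p;
         p∩q⊆p; p∩q⊆q; x∈p∩q⁺; nonempty?; Empty-unique; ∣⊥∣≡0)
open import Data.Vec.Base using (_∷_; here; there)
open import Data.Product using (_×_; _,_; proj₁; proj₂; ∃-syntax)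
open import Data.Empty using (⊥)
open import Data.Sum using (inj₁; inj₂)
open import Function.Bundles using (_⇔_; mk⇔)
open import Induction.WellFounded using (Acc; acc)
open import Relation.Binary.Core using (Rel; _⇒_)
open import Relation.Binary.Definitions using (Transitive)
open import Relation.Binary.PropositionalEquality using (_≡_; refl; sym; trans; cong; isEquivalence)
open import Relation.Binary.Structures using (IsPartialOrder)
open import Relation.Binary.Construct.Closure.Transitive using (TransClosure; [_]; _∷_; _++_)
open import Relation.Nullary using (¬_; yes; no; ¬?)
open import Relation.Nullary.Decidable using (decidable-stable; _×-dec_)

TransClosure-least : ∀ {a ℓ₁ ℓ₂} {A : Set a} {R : Rel A ℓ₁} {S : Rel A ℓ₂} →
                     R ⇒ S → Transitive S → TransClosure R ⇒ S
TransClosure-least R⇒S S-trans [ r ]    = R⇒S r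
TransClosure-least R⇒S S-trans (r ∷ rs) = S-trans (R⇒S r) (TransClosure-least R⇒S S-trans rs)

private
  variable
    n d : ℕ
    p q : Subset n
    x : Fin n

x∈p⇒suc∣p-x∣≡∣p∣ : x ∈ p → suc ∣ p - x ∣ ≡ ∣ p ∣
x∈p⇒suc∣p-x∣≡∣p∣ {p = inside ∷ p} here = cong (λ r → suc ∣ r ∣) (p─⊥≡p p)
x∈p⇒suc∣p-x∣≡∣p∣ {p = inside  ∷ p} (there x∈p) = cong suc (x∈p⇒suc∣p-x∣≡∣p∣ x∈p)
x∈p⇒suc∣p-x∣≡∣p∣ {p = outside ∷ p} (there x∈p) = x∈p⇒suc∣p-x∣≡∣p∣ x∈p

∣p∣≡suc⇒Nonempty : ∀ {n d} {p : Subset n} → ∣ p ∣ ≡ suc d → Nonempty p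
∣p∣≡suc⇒Nonempty {n = n} {p = p} ∣p∣≡1+d = decidable-stable (nonempty? p) λ empty →
  0≢1+n (trans (sym (trans (cong ∣_∣ (Empty-unique empty)) (∣⊥∣≡0 n))) ∣p∣≡1+d)

p⊆q∧x∉p⇒p⊆q-x : p ⊆ q → x ∉ p → p ⊆ q - x
p⊆q∧x∉p⇒p⊆q-x p⊆q x∉p y∈p = x∈p∧x≢y⇒x∈p-y (p⊆q y∈p) λ { refl → x∉p y∈p }

∣p∣<∣q∣⇒∃∈q∖p : ∣ p ∣ ℕ.< ∣ q ∣ → ∃[ x ] (x ∈ q × x ∉ p)
∣p∣<∣q∣⇒∃∈q∖p {p = p} {q = q} ∣p∣<∣q∣ =
  decidable-stable (any? λ x → (x ∈? q) ×-dec ¬? (x ∈? p)) λ ∄ →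
    <⇒≱ ∣p∣<∣q∣ (p⊆q⇒∣p∣≤∣q∣ λ {x} x∈q → decidable-stable (x ∈? p) λ x∉p → ∄ (x , x∈q , x∉p))

p⊆q∧∣q∣≤∣p∣⇒q⊆p : p ⊆ q → ∣ q ∣ ℕ.≤ ∣ p ∣ → q ⊆ p
p⊆q∧∣q∣≤∣p∣⇒q⊆p {p = p} p⊆q ∣q∣≤∣p∣ {x} x∈q = decidable-stable (x ∈? p) λ x∉p →
  <⇒≱ (p⊂q⇒∣p∣<∣q∣ (p⊆q , x , x∈q , x∉p)) ∣q∣≤∣p∣

⊆-codimOne : p ⊆ q → ∣ q ∣ ≡ suc ∣ p ∣ → ∃[ x ] (x ∈ q × x ∉ p × q - x ⊆ p)
⊆-codimOne {p = p} {q = q} p⊆q ∣q∣≡1+∣p∣ with ∣p∣<∣q∣⇒∃∈q∖p (≤-reflexive (sym ∣q∣≡1+∣p∣))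
... | x , x∈q , x∉p = x , x∈q , x∉p , p⊆q∧∣q∣≤∣p∣⇒q⊆p (p⊆q∧x∉p⇒p⊆q-x p⊆q x∉p) ∣q-x∣≤∣p∣
  where
  ∣q-x∣≤∣p∣ : ∣ q - x ∣ ℕ.≤ ∣ p ∣
  ∣q-x∣≤∣p∣ = ℕ.s≤s⁻¹ (<-≤-trans (x∈p⇒∣p-x∣<∣p∣ x∈q) (≤-reflexive ∣q∣≡1+∣p∣))

module _ {n d m : ℕ} (Δ : PureComplex n d m) where
  open PureComplex Δ

  private
    variable
      e i j k : Fin m
      F G : Subset n

  R≤-refl : R≤ Δ e e
  R≤-refl _ (v∈e , _) = v∈e

  R≤⇒R⊆∩ : R≤ Δ e j → ∀ v → _∈R_ Δ v e → v ∈ ch e ∩ ch j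
  R≤⇒R⊆∩ R≤ej v v∈Re = x∈p∩q⁺ (proj₁ v∈Re , R≤ej v v∈Re)

  adjacent-refl : ∀ e → Adjacent Δ e e
  adjacent-refl e with ∣p∣≡suc⇒Nonempty {p = ch e} (ch-size e)
  ... | v , v∈e = ch e - v , facet , facet
    where
    facet : IsCodimOneFaceOf Δ (ch e - v) e
    facet = p─q⊆p _ _ , suc-injective (trans (x∈p⇒suc∣p-x∣≡∣p∣ {p = ch e} v∈e) (ch-size e))

  facet-opposite-vertex : IsCodimOneFaceOf Δ G e → InEarlier Δ e G → ∃[ v ] (_∈R_ Δ v e × v ∉ G)
  facet-opposite-vertex {e = e} (G⊆e , ∣G∣≡d) (_ , i , i<e , G⊆i)
    with ⊆-codimOne G⊆e (trans (ch-size e) (cong suc (sym ∣G∣≡d)))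
  ... | v , v∈e , v∉G , e-v⊆G = v , (v∈e , p─q⊆p _ _ , i , i<e , ⊆-trans e-v⊆G G⊆i) , v∉G

  thin⇒at-most-two-chambers : Thin Δ → IsCodimOneFace Δ G → i < j → j < k →
                              G ⊆ ch i → G ⊆ ch j → G ⊆ ch k → ⊥
  thin⇒at-most-two-chambers thin G-face i<j j<k G⊆i G⊆j G⊆k with thin _ G-face
  ... | _ , _ , _ , _ , _ , only with only _ G⊆i | only _ G⊆j | only _ G⊆k
  ... | inj₁ refl | inj₁ refl | _         = <-irrefl refl i<j
  ... | inj₂ refl | inj₂ refl | _         = <-irrefl refl i<j
  ... | _         | inj₁ refl | inj₁ refl = <-irrefl refl j<k
  ... | _         | inj₂ refl | inj₂ refl = <-irrefl refl j<k
  ... | inj₁ refl | inj₂ refl | inj₁ refl = <-irrefl refl (<-trans i<j j<k)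
  ... | inj₂ refl | inj₁ refl | inj₂ refl = <-irrefl refl (<-trans i<j j<k)

  -- A vertex v of R(i) outside ch j would put G ⊆ ch i - v into a chamber k <_S i,
  -- so G would lie in the three chambers k, i, j.
  shared-facet⇒R≤ : Thin Δ → IsCodimOneFaceOf Δ G i → IsCodimOneFaceOf Δ G j → i < j → R≤ Δ i j
  shared-facet⇒R≤ {j = j} thin (G⊆i , ∣G∣≡d) (G⊆j , _) i<j v (v∈i , _ , k , k<i , i-v⊆k) =
    decidable-stable (v ∈? ch j) λ v∉j →
      thin⇒at-most-two-chambers thin ((_ , G⊆i) , ∣G∣≡d) k<i i<j
        (⊆-trans (p⊆q∧x∉p⇒p⊆q-x G⊆i (λ v∈G → v∉j (G⊆j v∈G))) i-v⊆k) G⊆i G⊆j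

  module _ (shelling : IsShelling Δ) where

    earlier-facet : i < j → F ⊆ ch i → F ⊆ ch j →
                    ∃[ G ] (IsCodimOneFaceOf Δ G j × InEarlier Δ j G × F ⊆ G)
    earlier-facet {i = i} {j = j} {F = F} i<j F⊆i F⊆j =
      proj₂ (shelling j (≤-<-trans ℕ.z≤n i<j)) F (F⊆j , i , i<j , F⊆i)

    later⇒¬R≤ : j < e → ¬ R≤ Δ e j
    later⇒¬R≤ j<e R≤ej with earlier-facet j<e (p∩q⊆q _ _) (p∩q⊆p _ _)
    ... | G , G-facet , G-earlier , e∩j⊆G with facet-opposite-vertex G-facet G-earlier
    ... | v , v∈Re , v∉G = v∉G (e∩j⊆G (R≤⇒R⊆∩ R≤ej v v∈Re))

    R≤⇒≤ : R≤ Δ e j → e ≤ j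
    R≤⇒≤ R≤ej = ≮⇒≥ λ j<e → later⇒¬R≤ j<e R≤ej

    ≤C-isPartialOrder : IsPartialOrder _≡_ (_≤C_ Δ)
    ≤C-isPartialOrder = record
      { isPreorder = record
        { isEquivalence = isEquivalence
        ; reflexive     = λ { refl → [ R≤-refl ] }
        ; trans         = _++_
        }
      ; antisym = λ e≤Cj j≤Ce → ≤-antisym (≤C⇒≤ e≤Cj) (≤C⇒≤ j≤Ce)
      }
      where
      ≤C⇒≤ : _≤C_ Δ ⇒ _≤_
      ≤C⇒≤ = TransClosure-least R≤⇒≤ ≤-trans

    R≤⇒≤Cr : Thin Δ → Acc _<_ j → R≤ Δ e j → _≤Cr_ Δ e j
    R≤⇒≤Cr {j = j} {e = e} thin (acc rec) R≤ej with e ≟ j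
    ... | yes refl = [ R≤ej , adjacent-refl e ]  -- Adjacent does not require distinct chambers
    ... | no e≢j with earlier-facet (≤∧≢⇒< (R≤⇒≤ R≤ej) e≢j) (p∩q⊆p _ _) (p∩q⊆q _ _)
    ... | G , G-facet-j , (_ , i , i<j , G⊆i) , e∩j⊆G =
      R≤⇒≤Cr thin (rec i<j) R≤ei ++
      [ shared-facet⇒R≤ thin G-facet-i G-facet-j i<j , G , G-facet-i , G-facet-j ]
      where
      G-facet-i : IsCodimOneFaceOf Δ G i
      G-facet-i = G⊆i , proj₂ G-facet-j
      R≤ei : R≤ Δ e i
      R≤ei v v∈Re = G⊆i (e∩j⊆G (R≤⇒R⊆∩ R≤ej v v∈Re))

    ≤C⇔≤Cr : Thin Δ → ∀ e j → _≤C_ Δ e j ⇔ _≤Cr_ Δ e j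
    ≤C⇔≤Cr thin _ _ = mk⇔
      (TransClosure-least (λ {_} {j} → R≤⇒≤Cr thin (<-wellFounded j)) _++_)
      (TransClosure-least (λ R≤∧adj → [ proj₁ R≤∧adj ]) _++_)

lemma3p2 : (n d m : ℕ) (Δ : PureComplex n d m) → Thin Δ → IsShelling Δ →
    (∀ (E D : Fin m) → (_≤C_ Δ E D ⇔ _≤Cr_ Δ E D))
    × IsPartialOrder _≡_ (_≤C_ Δ)
lemma3p2 n d m Δ thin shelling = ≤C⇔≤Cr Δ shelling thin , ≤C-isPartialOrder Δ shelling
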